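{- Let $(v_1,v_2,v_3,v_4,v_5)$ be a Tanaka quintuple in a connected graph $G$, and let $r=d(v_1,v_3)=d(v_2,v_4)$. If $(v_1=a_0,a_1,\dots,a_r=v_3)$ and $(v_2=b_0,b_1,\dots,b_r=v_4)$ are geodesics, then $\{a_0,\dots,a_r\}\cap\{b_0,\dots,b_r\}=\emptyset$ and $v_5\notin\{a_0,\dots,a_r,b_0,\dots,b_r\}$. If $(v_5=e_0,e_1,\dots,e_p=v_1)$ and $(v_5=f_0,f_1,\dots,f_q=v_4)$ are geodesics, then $v_4\notin\{e_0,\dots,e_p\}$ and $v_1\notin\{f_0,\dots,f_q\}$.
   Context: For a connected graph $G=(V,E)$ with graph distance $d$, a geodesic is a shortest walk between two vertices. A Tanaka quintuple is a sequence of vertices $(v_1,v_2,v_3,v_4,v_5)$ with $\{v_1,v_2\},\{v_3,v_4\}\in E$, $d(v_1,v_3)=d(v_2,v_4)=d(v_1,v_4)-1=d(v_2,v_3)-1$, $d(v_5,v_2)=d(v_5,v_1)+1$ and $d(v_5,v_3)=d(v_5,v_4)+1$. -}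

module Defs where

open import Data.Nat using (ℕ; zero; suc; _<_)
open import Data.Fin using (Fin; zero; suc; inject₁; fromℕ)
open import Data.Product using (Σ; ∃; _×_; _,_)
open import Relation.Binary.PropositionalEquality using (_≡_)
open import Relation.Nullary using (¬_)

record Graph : Set₁ where
  field
    V      : Set
    E      : V → V → Set
    E-sym  : ∀ {x y} → E x y → E y x
    E-irr  : ∀ {x} → ¬ E x x

module _ (G : Graph) where
  open Graph G

  IsWalk : (n : ℕ) → (Fin (suc n) → V) → Set
  IsWalk n w = (i : Fin n) → E (w (inject₁ i)) (w (suc i))

  WalkFromTo : V → V → (n : ℕ) → (Fin (suc n) → V) → Set
  WalkFromTo x y n w = (w zero ≡ x) × (w (fromℕ n) ≡ y) × IsWalk n w

  HasWalk : V → V → ℕ → Set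
  HasWalk x y n = Σ (Fin (suc n) → V) (WalkFromTo x y n)

  Connected : Set
  Connected = ∀ x y → ∃ λ n → HasWalk x y n

  Dist : V → V → ℕ → Set
  Dist x y n = HasWalk x y n × (∀ m → m < n → ¬ HasWalk x y m)

  Geodesic : V → V → (n : ℕ) → (Fin (suc n) → V) → Set
  Geodesic x y n w = WalkFromTo x y n w × Dist x y n

  record Tanaka (v₁ v₂ v₃ v₄ v₅ : V) : Set where
    field
      e₁₂ : E v₁ v₂
      e₃₄ : E v₃ v₄
      r   : ℕ
      d₁₃ : Dist v₁ v₃ r
      d₂₄ : Dist v₂ v₄ r
      d₁₄ : Dist v₁ v₄ (suc r)
      d₂₃ : Dist v₂ v₃ (suc r)
      s   : ℕ
      d₅₁ : Dist v₅ v₁ s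
      d₅₂ : Dist v₅ v₂ (suc s)
      t   : ℕ
      d₅₄ : Dist v₅ v₄ t
      d₅₃ : Dist v₅ v₃ (suc t)

-- Every vertex c of a geodesic from x to y splits d(x,y) as d(x,c) + d(c,y), so
-- each forbidden coincidence would let one glue walks into a walk that is shorter
-- than a distance prescribed by the Tanaka quintuple.  For instance, if a geodesic
-- from v₁ to v₃ met one from v₂ to v₄ in c, then
--   d(v₁,v₄) + d(v₂,v₃) ≤ d(v₁,c) + d(c,v₄) + d(v₂,c) + d(c,v₃) = 2r < 2r + 2;
-- and if v₅ lay on a geodesic from v₁ to v₃, then
--   r + 1 = d(v₁,v₄) ≤ d(v₁,v₅) + d(v₅,v₄) < d(v₁,v₅) + d(v₅,v₃) = r.
module Submission where

open import Defs
open import Data.Nat using (ℕ; zero; suc; _+_; _≤_; _<_)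
open import Data.Nat.Properties
open import Data.Nat.Tactic.RingSolver using (solve-∀)
open import Data.Fin using (Fin; zero; suc; fromℕ)
open import Data.Vec.Functional using () renaming (_∷_ to _◂_)
open import Data.Product using (_×_; _,_)
open import Function using (_$_)
open import Relation.Binary.PropositionalEquality using (_≡_; _≢_; refl; cong; cong₂; subst)

+-cross : ∀ a b c d → (a + d) + (c + b) ≡ (a + b) + (c + d)
+-cross = solve-∀

module _ (G : Graph) where
  open Graph G

  infixr 5 _∷_ _++_
  infixl 5 _∷ʳ_

  data Walk : V → V → ℕ → Set where
    []  : ∀ {x} → Walk x x 0
    _∷_ : ∀ {x y z n} → E x y → Walk y z n → Walk x z (suc n)

  _++_ : ∀ {x y z m n} → Walk x y m → Walk y z n → Walk x z (m + n)
  []      ++ q = q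
  (e ∷ p) ++ q = e ∷ (p ++ q)

  _∷ʳ_ : ∀ {x y z n} → Walk x y n → E y z → Walk x z (suc n)
  []        ∷ʳ e = e ∷ []
  (e′ ∷ p) ∷ʳ e = e′ ∷ (p ∷ʳ e)

  reverse : ∀ {x y n} → Walk x y n → Walk y x n
  reverse []      = []
  reverse (e ∷ p) = reverse p ∷ʳ E-sym e

  toWalk : ∀ {n} (w : Fin (suc n) → V) → IsWalk G n w → Walk (w zero) (w (fromℕ n)) n
  toWalk {zero}  w W = []
  toWalk {suc n} w W = W zero ∷ toWalk (λ j → w (suc j)) (λ i → W (suc i))

  fromWalk : ∀ {x y n} → Walk x y n → HasWalk G x y n
  fromWalk {x} []      = (λ _ → x) , refl , refl , λ ()
  fromWalk {x} (e ∷ p) with fromWalk p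
  ... | w , refl , w-end , W = x ◂ w , refl , w-end , λ { zero → e ; (suc i) → W i }

  Dist⇒Walk : ∀ {x y n} → Dist G x y n → Walk x y n
  Dist⇒Walk ((w , refl , refl , W) , _) = toWalk w W

  Dist-minimal : ∀ {x y m n} → Dist G x y n → Walk x y m → n ≤ m
  Dist-minimal (_ , shortest) p = ≮⇒≥ (λ m<n → shortest _ m<n (fromWalk p))

  Dist-unique : ∀ {x y m n} → Dist G x y m → Dist G x y n → m ≡ n
  Dist-unique d d′ = ≤-antisym (Dist-minimal d (Dist⇒Walk d′)) (Dist-minimal d′ (Dist⇒Walk d))

  data Via (x c y : V) (n : ℕ) : Set where
    via : ∀ {k l} → k + l ≡ n → Walk x c k → Walk c y l → Via x c y n

  Via-vertex : ∀ {n} (w : Fin (suc n) → V) → IsWalk G n w →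
               (i : Fin (suc n)) → Via (w zero) (w i) (w (fromℕ n)) n
  Via-vertex         w W zero    = via refl [] (toWalk w W)
  Via-vertex {suc n} w W (suc i) with Via-vertex (λ j → w (suc j)) (λ j → W (suc j)) i
  ... | via k+l≡n p q = via (cong suc k+l≡n) (W zero ∷ p) q

  geodesic-via : ∀ {x y m n w} → Dist G x y m → Geodesic G x y n w →
                 (i : Fin (suc n)) → Via x (w i) y m
  geodesic-via d ((refl , refl , W) , d′) i =
    subst (Via _ _ _) (Dist-unique d′ d) (Via-vertex _ W i)

  module _ {v₁ v₂ v₃ v₄ v₅ : V} (T : Tanaka G v₁ v₂ v₃ v₄ v₅) where
    open Tanaka T
    open ≤-Reasoning

    via₁₃-via₂₄-disjoint : ∀ {c c′} → Via v₁ c v₃ r → Via v₂ c′ v₄ r → c ≢ c′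
    via₁₃-via₂₄-disjoint (via {k₁} {l₁} e₁ p₁ q₁) (via {k₂} {l₂} e₂ p₂ q₂) refl =
      <-irrefl refl $ begin-strict
        r + r                  <⟨ +-mono-< (Dist-minimal d₁₄ (p₁ ++ q₂)) (Dist-minimal d₂₃ (p₂ ++ q₁)) ⟩
        (k₁ + l₂) + (k₂ + l₁)  ≡⟨ +-cross k₁ l₁ k₂ l₂ ⟩
        (k₁ + l₁) + (k₂ + l₂)  ≡⟨ cong₂ _+_ e₁ e₂ ⟩
        r + r                  ∎

    v₅-not-via₁₃ : ∀ {c} → Via v₁ c v₃ r → v₅ ≢ c
    v₅-not-via₁₃ (via {k} {l} k+l≡r p q) refl = <-irrefl refl $ begin-strict
      r      <⟨ Dist-minimal d₁₄ (p ++ Dist⇒Walk d₅₄) ⟩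
      k + t  <⟨ +-monoʳ-< k (Dist-minimal d₅₃ q) ⟩
      k + l  ≡⟨ k+l≡r ⟩
      r      ∎

    v₅-not-via₂₄ : ∀ {c} → Via v₂ c v₄ r → v₅ ≢ c
    v₅-not-via₂₄ (via {k} {l} k+l≡r p q) refl = <-irrefl refl $ begin-strict
      r      <⟨ Dist-minimal d₁₄ (reverse (Dist⇒Walk d₅₁) ++ q) ⟩
      s + l  <⟨ +-monoˡ-< l (Dist-minimal d₅₂ (reverse p)) ⟩
      k + l  ≡⟨ k+l≡r ⟩
      r      ∎

    v₄-not-via₅₁ : ∀ {c} → Via v₅ c v₁ s → v₄ ≢ c
    v₄-not-via₅₁ (via {k} {l} k+l≡s p q) refl = <-irrefl refl $ begin-strict
      s      <⟨ Dist-minimal d₅₂ (p ++ reverse (Dist⇒Walk d₂₄)) ⟩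
      k + r  <⟨ +-monoʳ-< k (Dist-minimal d₁₄ (reverse q)) ⟩
      k + l  ≡⟨ k+l≡s ⟩
      s      ∎

    v₁-not-via₅₄ : ∀ {c} → Via v₅ c v₄ t → v₁ ≢ c
    v₁-not-via₅₄ (via {k} {l} k+l≡t p q) refl = <-irrefl refl $ begin-strict
      t      <⟨ Dist-minimal d₅₃ (p ++ Dist⇒Walk d₁₃) ⟩
      k + r  <⟨ +-monoʳ-< k (Dist-minimal d₁₄ q) ⟩
      k + l  ≡⟨ k+l≡t ⟩
      t      ∎

lemma3p3 : (G : Graph) → Connected G →
    (v₁ v₂ v₃ v₄ v₅ : Graph.V G) → Tanaka G v₁ v₂ v₃ v₄ v₅ →
    (r : ℕ) → Dist G v₁ v₃ r →
    ((a b : Fin (suc r) → Graph.V G) →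
       Geodesic G v₁ v₃ r a → Geodesic G v₂ v₄ r b →
       ((i j : Fin (suc r)) → a i ≢ b j)
       × ((i : Fin (suc r)) → v₅ ≢ a i)
       × ((j : Fin (suc r)) → v₅ ≢ b j))
    × ((p q : ℕ) (e : Fin (suc p) → Graph.V G) (f : Fin (suc q) → Graph.V G) →
       Geodesic G v₅ v₁ p e → Geodesic G v₅ v₄ q f →
       ((i : Fin (suc p)) → v₄ ≢ e i)
       × ((j : Fin (suc q)) → v₁ ≢ f j))
lemma3p3 G _ _ _ _ _ _ T _ _ =
    (λ a b α β →
        (λ i j → via₁₃-via₂₄-disjoint G T (geodesic-via G d₁₃ α i) (geodesic-via G d₂₄ β j))
      , (λ i → v₅-not-via₁₃ G T (geodesic-via G d₁₃ α i))
      , (λ j → v₅-not-via₂₄ G T (geodesic-via G d₂₄ β j)))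
  , (λ _ _ e f ε φ →
        (λ i → v₄-not-via₅₁ G T (geodesic-via G d₅₁ ε i))
      , (λ j → v₁-not-via₅₄ G T (geodesic-via G d₅₄ φ j)))
  where open Tanaka T
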